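{- Let $G$ be a graph of order $n$ with $\delta(G)\geq\frac56n$, and suppose the edges of $G$ are coloured with three colours. If there exists a vertex $v$ which is not incident to edges of all three colours, then there exists a monochromatic component of order at least $\frac n2$.
   Context: $\delta(G)$ denotes the minimum degree of $G$. For an edge-colouring of $G$, a monochromatic component of a given colour is a connected component of the graph formed by the edges of that colour (on the vertices incident with such edges); its order is its number of vertices. -}

module Defs where

open import Data.Nat using (ℕ; zero; suc; _+_; _*_; _≤_)
open import Data.Bool using (Bool; true; false; if_then_else_)
open import Data.Fin using (Fin)
open import Data.List using (List; length; map; allFin)
open import Data.Nat.ListAction using (sum)
open import Data.List.Membership.Propositional using (_∈_)
open import Data.List.Relation.Unary.Unique.Propositional using (Unique)
open import Data.List.Relation.Unary.All using (All)
open import Data.Product using (Σ; _×_; ∃; ∃-syntax)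
open import Relation.Binary.PropositionalEquality using (_≡_; _≢_)
open import Relation.Nullary using (¬_)

record Graph (n : ℕ) : Set where
  field
    adj   : Fin n → Fin n → Bool
    sym   : ∀ u v → adj u v ≡ adj v u
    irrfl : ∀ v → adj v v ≡ false
open Graph public

degree : ∀ {n} → Graph n → Fin n → ℕ
degree {n} G v = sum (map (λ u → if adj G v u then 1 else 0) (allFin n))

MinDegAtLeastFiveSixths : ∀ {n} → Graph n → Set
MinDegAtLeastFiveSixths {n} G = ∀ v → 5 * n ≤ 6 * degree G v

-- A 3-edge-colouring: a colour for each (unordered) edge. It is given as a
-- function on ordered pairs that is symmetric on edges; its values on
-- non-edges are irrelevant.
record EdgeColouring {n : ℕ} (G : Graph n) (k : ℕ) : Set where
  field
    col    : Fin n → Fin n → Fin k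
    colSym : ∀ u v → adj G u v ≡ true → col u v ≡ col v u
open EdgeColouring public

ColEdge : ∀ {n k} {G : Graph n} → EdgeColouring G k → Fin k → Fin n → Fin n → Set
ColEdge {G = G} c i u v = (adj G u v ≡ true) × (col c u v ≡ i)

data Reach {n k} {G : Graph n} (c : EdgeColouring G k) (i : Fin k) (r : Fin n) : Fin n → Set where
  here : Reach c i r r
  step : ∀ {u w} → Reach c i r u → ColEdge c i u w → Reach c i r w

IncidentCol : ∀ {n k} {G : Graph n} → EdgeColouring G k → Fin k → Fin n → Set
IncidentCol c i v = ∃[ u ] ColEdge c i v u

-- There is a monochromatic component (of some colour i, i.e. a connected
-- component of the colour-i subgraph on the vertices incident to colour-i
-- edges) of order at least m/2: some vertex r incident to a colour-i edge
-- and a list of distinct vertices, all in the colour-i component of r,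
-- of length ℓ with 2ℓ ≥ m.
HasMonoComponentOfOrderAtLeastHalf : ∀ {n k} {G : Graph n} → EdgeColouring G k → ℕ → Set
HasMonoComponentOfOrderAtLeastHalf {n} c m =
  ∃[ i ] ∃[ r ] (IncidentCol c i r ×
    ∃[ S ] (Unique S × All (Reach c i r) S × (m ≤ 2 * length S)))

module Submission where

-- Let a, b be the two other colours. For a colour i, the i-ball Bᵢ of v is
-- the set of vertices joined to v by an i-coloured walk of length at most 2;
-- it lies inside the i-component of v. If |Bₐ| ≥ n/2 or |B_b| ≥ n/2 we are
-- done. Otherwise let Rᵢ be the set of neighbours of v outside Bᵢ. Since
-- d(v) + 1 ≤ |Bᵢ| + |Rᵢ|, the degree condition gives |Rᵢ| > n/3. Every
-- neighbour of v lies in Bₐ or B_b, so R_a and R_b are disjoint; an edge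
-- between R_b and R_a cannot have colour a or b (it would extend a ball), so
-- it has colour j. Every vertex misses at most n/6 vertices, hence any two
-- vertices have a common neighbour in each of R_a, R_b, which makes
-- R_a ∪ R_b part of one j-component, of order > 2n/3 ≥ n/2.

open import Defs hiding (sym)
open import Level using (0ℓ)
open import Data.Nat using (ℕ; zero; suc; _+_; _*_; _≤_; _<_; z≤n; s≤s; _≤?_)
open import Data.Nat.Properties
open import Data.Nat.Tactic.RingSolver using (solve)
open import Data.Nat.ListAction using (sum)
open import Data.Bool using (Bool; true; false; if_then_else_)
import Data.Bool.Properties as Bool
open import Data.Fin using (Fin; zero; suc)
import Data.Fin.Properties as Fin
open import Data.List using (List; []; _∷_; length; map; filter; allFin)
open import Data.List.Properties using (length-filter; length-tabulate)
open import Data.List.Membership.Propositional using (_∈_)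
open import Data.List.Membership.Propositional.Properties using (∈-filter⁺; ∈-allFin)
open import Data.Product using (_×_; _,_; proj₁; proj₂; ∃-syntax)
open import Data.Sum using (_⊎_; inj₁; inj₂; [_,_])
open import Data.Empty using (⊥; ⊥-elim)
open import Relation.Binary.PropositionalEquality using (_≡_; refl; sym; trans; cong; subst)
open import Relation.Nullary using (¬_; Dec; yes; no; _×-dec_; _⊎-dec_)
open import Relation.Unary using (Pred; Decidable; _⊆_; _∪_; _∩_; ∁)
open import Relation.Unary.Properties using (_∪?_; _∩?_; ∁?)

-- Linear arithmetic. Each inequality is obtained by adding scaled
-- hypotheses and cancelling a common summand k; the two identities saying
-- that both sides have that shape are ring identities.

≤-cancel : ∀ {a b l r} k → l ≤ r → l ≡ a + k → r ≡ b + k → a ≤ b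
≤-cancel {a} {b} k l≤r refl refl = +-cancelʳ-≤ k a b l≤r

non-neighbours-bound : ∀ {n d m} → m + d ≤ n → 5 * n ≤ 6 * d → 6 * m ≤ n
non-neighbours-bound {n} {d} {m} h₁ h₂ =
  ≤-cancel (5 * n + 6 * d) (+-mono-≤ (*-monoʳ-≤ 6 h₁) h₂) lhs rhs
  where
  lhs : 6 * (m + d) + 5 * n ≡ 6 * m + (5 * n + 6 * d)
  lhs = solve (n ∷ d ∷ m ∷ [])
  rhs : 6 * n + 6 * d ≡ n + (5 * n + 6 * d)
  rhs = solve (n ∷ d ∷ [])

remainder-bound : ∀ {n d B R} → d + 1 ≤ B + R → 2 * B < n → 5 * n ≤ 6 * d → n < 3 * R
remainder-bound {n} {d} {B} {R} h₁ h₂ h₃ =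
  *-cancelˡ-≤ 2 (≤-trans (m≤m+n (2 * suc n) 7) (≤-cancel (6 * d + 6 * B + 3 * n)
    (+-mono-≤ (+-mono-≤ h₃ (*-monoʳ-≤ 6 h₁)) (*-monoʳ-≤ 3 h₂)) lhs rhs))
  where
  lhs : 5 * n + 6 * (d + 1) + 3 * (1 + 2 * B) ≡ (2 * (1 + n) + 7) + (6 * d + 6 * B + 3 * n)
  lhs = solve (n ∷ d ∷ B ∷ [])
  rhs : 6 * d + 6 * (B + R) + 3 * n ≡ 2 * (3 * R) + (6 * d + 6 * B + 3 * n)
  rhs = solve (n ∷ d ∷ B ∷ R ∷ [])

thirds-minus-sixths : ∀ {n p c x y} → p ≤ c + x + y → 6 * x ≤ n → 6 * y ≤ n → n < 3 * p → 1 ≤ c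
thirds-minus-sixths {n} {p} {c} {x} {y} h₁ h₂ h₃ h₄ = positive (≤-cancel (2 * n + 6 * p + 6 * x + 6 * y)
  (+-mono-≤ (+-mono-≤ (+-mono-≤ (*-monoʳ-≤ 2 h₄) (*-monoʳ-≤ 6 h₁)) h₂) h₃) lhs rhs)
  where
  lhs : 2 * (1 + n) + 6 * p + 6 * x + 6 * y ≡ 2 + (2 * n + 6 * p + 6 * x + 6 * y)
  lhs = solve (n ∷ p ∷ x ∷ y ∷ [])
  rhs : 2 * (3 * p) + 6 * (c + x + y) + n + n ≡ 6 * c + (2 * n + 6 * p + 6 * x + 6 * y)
  rhs = solve (n ∷ p ∷ c ∷ x ∷ y ∷ [])
  positive : ∀ {c} → 2 ≤ 6 * c → 1 ≤ c
  positive {suc _} _ = s≤s z≤n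

thirds-make-half : ∀ {n p q s} → p + q ≤ s → n < 3 * p → n < 3 * q → n ≤ 2 * s
thirds-make-half {n} {p} {q} {s} h₁ h₂ h₃ = <⇒≤ (*-cancelˡ-≤ 2 (≤-trans
  (≤-cancel (3 * p + 3 * q) (+-mono-≤ (+-mono-≤ (*-monoʳ-≤ 3 h₁) h₂) h₃) lhs rhs)
  three-s≤four-s))
  where
  lhs : 3 * (p + q) + (1 + n) + (1 + n) ≡ 2 * (1 + n) + (3 * p + 3 * q)
  lhs = solve (n ∷ p ∷ q ∷ [])
  rhs : 3 * s + 3 * p + 3 * q ≡ 3 * s + (3 * p + 3 * q)
  rhs = solve (p ∷ q ∷ s ∷ [])
  three-s≤four-s : 3 * s ≤ 2 * (2 * s)
  three-s≤four-s = ≤-trans (*-monoˡ-≤ s (n≤1+n 3)) (≤-reflexive four-s)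
    where
    four-s : 4 * s ≡ 2 * (2 * s)
    four-s = solve (s ∷ [])

two-from-half : ∀ {n s} → 6 ≤ n → n ≤ 2 * s → 2 ≤ s
two-from-half {s = zero}        six≤n n≤0 = ⊥-elim (<⇒≱ (≤-trans (s≤s z≤n) six≤n) n≤0)
two-from-half {s = suc zero}    six≤n n≤2 = ⊥-elim (<⇒≱ (≤-trans (s≤s (s≤s (s≤s z≤n))) six≤n) n≤2)
two-from-half {s = suc (suc _)} _     _   = s≤s (s≤s z≤n)

-- The constructors of All and AllPairs are brought into scope only after the
-- arithmetic, since overloading _∷_ makes the ring solver's variable lists
-- very expensive to elaborate.

open import Data.List.Relation.Unary.All as All using (All; _∷_)
open import Data.List.Relation.Unary.All.Properties using (all-filter)
open import Data.List.Relation.Unary.AllPairs using (_∷_)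
open import Data.List.Relation.Unary.Unique.Propositional using (Unique)
import Data.List.Relation.Unary.Unique.Propositional.Properties as Unique

module _ {A : Set} where

  filter-cover : {P Q R : Pred A 0ℓ} (P? : Decidable P) (Q? : Decidable Q) (R? : Decidable R) →
    P ⊆ Q ∪ R → ∀ xs → length (filter P? xs) ≤ length (filter Q? xs) + length (filter R? xs)
  filter-cover P? Q? R? P⊆Q∪R [] = z≤n
  filter-cover P? Q? R? P⊆Q∪R (x ∷ xs) with ih ← filter-cover P? Q? R? P⊆Q∪R xs | P? x | Q? x | R? x
  ... | yes _ | yes _ | yes _ = s≤s (≤-trans ih (+-monoʳ-≤ _ (n≤1+n _)))
  ... | yes _ | yes _ | no _  = s≤s ih
  ... | yes _ | no _  | yes _ = ≤-trans (s≤s ih) (≤-reflexive (sym (+-suc _ _)))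
  ... | yes p | no ¬q | no ¬r = ⊥-elim ([ ¬q , ¬r ] (P⊆Q∪R p))
  ... | no _  | yes _ | yes _ = m≤n⇒m≤1+n (≤-trans ih (+-monoʳ-≤ _ (n≤1+n _)))
  ... | no _  | yes _ | no _  = m≤n⇒m≤1+n ih
  ... | no _  | no _  | yes _ = ≤-trans ih (+-monoʳ-≤ _ (n≤1+n _))
  ... | no _  | no _  | no _  = ih

  filter-disjoint-∪ : {Q R : Pred A 0ℓ} (Q? : Decidable Q) (R? : Decidable R) →
    (∀ {x} → Q x → R x → ⊥) →
    ∀ xs → length (filter Q? xs) + length (filter R? xs) ≤ length (filter (Q? ∪? R?) xs)
  filter-disjoint-∪ Q? R? disjoint [] = z≤n
  filter-disjoint-∪ Q? R? disjoint (x ∷ xs) with ih ← filter-disjoint-∪ Q? R? disjoint xs | Q? x | R? x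
  ... | yes q | yes r = ⊥-elim (disjoint q r)
  ... | yes _ | no _  = s≤s ih
  ... | no _  | yes _ = ≤-trans (≤-reflexive (+-suc _ _)) (s≤s ih)
  ... | no _  | no _  = ih

  split-by : {P Q : Pred A 0ℓ} → Decidable Q → P ⊆ (P ∩ Q) ∪ ∁ Q
  split-by Q? {x} px with Q? x
  ... | yes q = inj₁ (px , q)
  ... | no ¬q = inj₂ ¬q

  filter-nonempty : {P : Pred A 0ℓ} (P? : Decidable P) {x : A} {xs : List A} →
    x ∈ xs → P x → 1 ≤ length (filter P? xs)
  filter-nonempty P? {xs = xs} x∈xs px with filter P? xs | ∈-filter⁺ P? x∈xs px
  ... | _ ∷ _ | _ = s≤s z≤n

  filter-witness : {P : Pred A 0ℓ} (P? : Decidable P) (xs : List A) →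
    1 ≤ length (filter P? xs) → ∃[ x ] P x
  filter-witness P? xs nonempty with filter P? xs | all-filter P? xs
  ... | x ∷ _ | px ∷ _ = x , px

  sum-indicator : (f : A → Bool) (xs : List A) →
    sum (map (λ x → if f x then 1 else 0) xs) ≡ length (filter (λ x → f x Bool.≟ true) xs)
  sum-indicator f [] = refl
  sum-indicator f (x ∷ xs) with f x
  ... | true  = cong suc (sum-indicator f xs)
  ... | false = sum-indicator f xs

∣_∣ : ∀ {n} {P : Pred (Fin n) 0ℓ} → Decidable P → ℕ
∣_∣ {n} P? = length (filter P? (allFin n))

module _ {n : ℕ} (G : Graph n) where

  Adj : Fin n → Pred (Fin n) 0ℓ
  Adj u w = adj G u w ≡ true

  adj? : ∀ u → Decidable (Adj u)
  adj? u w = adj G u w Bool.≟ true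

  adj-sym : ∀ {u w} → Adj u w → Adj w u
  adj-sym {u} {w} e = trans (Graph.sym G w u) e

  no-loop : ∀ v → ¬ Adj v v
  no-loop v e with trans (sym e) (irrfl G v)
  ... | ()

  CommonNeighbourIn : Pred (Fin n) 0ℓ → Set
  CommonNeighbourIn P = ∀ x x' → ∃[ z ] (P z × Adj x z × Adj x' z)

module _ {n k : ℕ} {G : Graph n} (c : EdgeColouring G k) where

  colEdge-sym : ∀ {i u w} → ColEdge c i u w → ColEdge c i w u
  colEdge-sym {u = u} {w} (e , cᵢ) = adj-sym G e , trans (sym (colSym c u w e)) cᵢ

  walk-trivial-or-incident : ∀ {i r z} → Reach c i r z → z ≡ r ⊎ IncidentCol c i r
  walk-trivial-or-incident here = inj₁ refl
  walk-trivial-or-incident (step w e) with walk-trivial-or-incident w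
  ... | inj₁ refl = inj₂ (_ , e)
  ... | inj₂ inc  = inj₂ inc

  root-incident : ∀ {i r S} → Unique S → All (Reach c i r) S → 2 ≤ length S → IncidentCol c i r
  root-incident ((z₁≢z₂ ∷ _) ∷ _) (w₁ ∷ w₂ ∷ _) (s≤s (s≤s z≤n))
    with walk-trivial-or-incident w₁ | walk-trivial-or-incident w₂
  ... | inj₁ refl | inj₁ refl = ⊥-elim (z₁≢z₂ refl)
  ... | inj₂ inc  | _         = inc
  ... | inj₁ _    | inj₂ inc  = inc

  dense-pair-connected : ∀ {P Q : Pred (Fin n) 0ℓ} {j y₀} →
    CommonNeighbourIn G P → CommonNeighbourIn G Q →
    (∀ {x y} → P x → Q y → Adj G x y → ColEdge c j x y) →
    Q y₀ → P ∪ Q ⊆ Reach c j y₀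
  dense-pair-connected {P} {Q} {j} {y₀} P-dense Q-dense cross qy₀ = λ { (inj₁ px) → reach-P px ; (inj₂ qy) → reach-Q qy }
    where
    -- y₀ — x' — y' — x, with x' ∈ P adjacent to y₀ and y' ∈ Q adjacent to x' and x.
    reach-P : P ⊆ Reach c j y₀
    reach-P {x} px with P-dense y₀ y₀
    ... | x' , px' , y₀x' , _ with Q-dense x' x
    ...   | y' , qy' , x'y' , xy' =
      step (step (step here (colEdge-sym (cross px' qy₀ (adj-sym G y₀x'))))
                 (cross px' qy' x'y'))
           (colEdge-sym (cross px qy' xy'))
    -- y is adjacent to some x ∈ P, which is reachable.
    reach-Q : Q ⊆ Reach c j y₀
    reach-Q {y} qy with P-dense y y
    ... | x , px , yx , _ = step (reach-P px) (cross px qy (adj-sym G yx))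

module MinDegree {n : ℕ} (G : Graph n) (δ≥ : MinDegAtLeastFiveSixths G) where

  degree-bound : ∀ x → 5 * n ≤ 6 * ∣ adj? G x ∣
  degree-bound x = subst (λ d → 5 * n ≤ 6 * d) (sum-indicator (adj G x) (allFin n)) (δ≥ x)

  non-neighbours-few : ∀ x → 6 * ∣ ∁? (adj? G x) ∣ ≤ n
  non-neighbours-few x = non-neighbours-bound {d = ∣ adj? G x ∣} {m = ∣ ∁? (adj? G x) ∣}
    (≤-trans (filter-disjoint-∪ (∁? (adj? G x)) (adj? G x) (λ ¬a a → ¬a a) (allFin n)) at-most-n)
    (degree-bound x)
    where
    at-most-n : ∣ ∁? (adj? G x) ∪? adj? G x ∣ ≤ n
    at-most-n = ≤-trans (length-filter _ (allFin n)) (≤-reflexive (length-tabulate (λ z → z)))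

  -- Each vertex is one of its own non-neighbours, so n ≥ 6.
  order-at-least-six : Fin n → 6 ≤ n
  order-at-least-six v = ≤-trans
    (*-monoʳ-≤ 6 (filter-nonempty (∁? (adj? G v)) (∈-allFin v) (no-loop G v)))
    (non-neighbours-few v)

  -- A set of more than n/3 vertices contains a common neighbour of any two
  -- vertices, since each of them misses at most n/6 vertices.
  large-sets-dense : {P : Pred (Fin n) 0ℓ} (P? : Decidable P) →
    n < 3 * ∣ P? ∣ → CommonNeighbourIn G P
  large-sets-dense {P} P? large x x' =
    regroup (filter-witness ((P? ∩? adj? G x) ∩? adj? G x') (allFin n) nonempty)
    where
    drop-x : ∣ P? ∣ ≤ ∣ P? ∩? adj? G x ∣ + ∣ ∁? (adj? G x) ∣
    drop-x = filter-cover P? (P? ∩? adj? G x) (∁? (adj? G x)) (split-by {P = P} (adj? G x)) (allFin n)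
    drop-x' : ∣ P? ∩? adj? G x ∣ ≤ ∣ (P? ∩? adj? G x) ∩? adj? G x' ∣ + ∣ ∁? (adj? G x') ∣
    drop-x' = filter-cover (P? ∩? adj? G x) ((P? ∩? adj? G x) ∩? adj? G x') (∁? (adj? G x'))
      (split-by {P = P ∩ Adj G x} (adj? G x')) (allFin n)
    nonempty : 1 ≤ ∣ (P? ∩? adj? G x) ∩? adj? G x' ∣
    nonempty = thirds-minus-sixths {p = ∣ P? ∣} {x = ∣ ∁? (adj? G x') ∣} {y = ∣ ∁? (adj? G x) ∣}
      (≤-trans drop-x (+-monoˡ-≤ _ drop-x'))
      (non-neighbours-few x') (non-neighbours-few x) large
    regroup : ∃[ z ] ((P z × Adj G x z) × Adj G x' z) → ∃[ z ] (P z × Adj G x z × Adj G x' z)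
    regroup (z , (pz , xz) , x'z) = z , pz , xz , x'z

  component-from-set : ∀ {k} (c : EdgeColouring G k) i r {P : Pred (Fin n) 0ℓ} (P? : Decidable P) →
    P ⊆ Reach c i r → n ≤ 2 * ∣ P? ∣ → HasMonoComponentOfOrderAtLeastHalf c n
  component-from-set c i r P? reach half =
    i , r , root-incident c unique reachable (two-from-half (order-at-least-six r) half) ,
    S , unique , reachable , half
    where
    S : List (Fin n)
    S = filter P? (allFin n)
    unique : Unique S
    unique = Unique.filter⁺ P? (Unique.allFin⁺ n)
    reachable : All (Reach c i r) S
    reachable = All.map reach (all-filter P? (allFin n))

module Ball {n k : ℕ} {G : Graph n} (c : EdgeColouring G k) (v : Fin n) where

  InBall : Fin k → Pred (Fin n) 0ℓ
  InBall i z = z ≡ v ⊎ ColEdge c i v z ⊎ ∃[ x ] (ColEdge c i v x × ColEdge c i x z)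

  colEdge? : ∀ i u w → Dec (ColEdge c i u w)
  colEdge? i u w = adj? G u w ×-dec (col c u w Fin.≟ i)

  inBall? : ∀ i → Decidable (InBall i)
  inBall? i z = (z Fin.≟ v) ⊎-dec colEdge? i v z ⊎-dec Fin.any? (λ x → colEdge? i v x ×-dec colEdge? i x z)

  ball-reach : ∀ {i} → InBall i ⊆ Reach c i v
  ball-reach (inj₁ refl)                 = here
  ball-reach (inj₂ (inj₁ e))             = step here e
  ball-reach (inj₂ (inj₂ (_ , e , e'))) = step (step here e) e'

  Outside : Fin k → Pred (Fin n) 0ℓ
  Outside i = Adj G v ∩ ∁ (InBall i)

  outside? : ∀ i → Decidable (Outside i)
  outside? i = adj? G v ∩? ∁? (inBall? i)

  neighbourhood-split : ∀ i → ∣ adj? G v ∣ + 1 ≤ ∣ inBall? i ∣ + ∣ outside? i ∣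
  neighbourhood-split i = begin
    ∣ adj? G v ∣ + 1           ≤⟨ +-monoʳ-≤ _ (filter-nonempty is-v? (∈-allFin v) refl) ⟩
    ∣ adj? G v ∣ + ∣ is-v? ∣    ≤⟨ filter-disjoint-∪ (adj? G v) is-v? (λ { e refl → no-loop G v e }) (allFin n) ⟩
    ∣ adj? G v ∪? is-v? ∣      ≤⟨ filter-cover _ _ _ covered (allFin n) ⟩
    ∣ inBall? i ∣ + ∣ outside? i ∣ ∎
    where
    open ≤-Reasoning
    is-v? : Decidable (_≡ v)
    is-v? z = z Fin.≟ v
    covered : Adj G v ∪ (_≡ v) ⊆ InBall i ∪ Outside i
    covered (inj₂ z≡v) = inj₁ (inj₁ z≡v)
    covered {z} (inj₁ e) with inBall? i z
    ... | yes b = inj₁ b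
    ... | no ¬b = inj₂ (e , ¬b)

Covers : Fin 3 → Fin 3 → Fin 3 → Set
Covers j a b = ∀ i → i ≡ j ⊎ i ≡ a ⊎ i ≡ b

covers-swap : ∀ {j a b} → Covers j a b → Covers j b a
covers-swap cov i with cov i
... | inj₁ e        = inj₁ e
... | inj₂ (inj₁ e) = inj₂ (inj₂ e)
... | inj₂ (inj₂ e) = inj₂ (inj₁ e)

other-colours : ∀ j → ∃[ a ] ∃[ b ] Covers j a b
other-colours zero = suc zero , suc (suc zero) ,
  λ { zero → inj₁ refl ; (suc zero) → inj₂ (inj₁ refl) ; (suc (suc zero)) → inj₂ (inj₂ refl) }
other-colours (suc zero) = zero , suc (suc zero) ,
  λ { zero → inj₂ (inj₁ refl) ; (suc zero) → inj₁ refl ; (suc (suc zero)) → inj₂ (inj₂ refl) }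
other-colours (suc (suc zero)) = zero , suc zero ,
  λ { zero → inj₂ (inj₁ refl) ; (suc zero) → inj₂ (inj₂ refl) ; (suc (suc zero)) → inj₁ refl }

module MissingColour {n : ℕ} {G : Graph n} (c : EdgeColouring G 3) (δ≥ : MinDegAtLeastFiveSixths G)
                     (v : Fin n) (j : Fin 3) (no-j : ¬ IncidentCol c j v) where
  open MinDegree G δ≥
  open Ball c v

  ball-component : ∀ i → n ≤ 2 * ∣ inBall? i ∣ → HasMonoComponentOfOrderAtLeastHalf c n
  ball-component i = component-from-set c i v (inBall? i) ball-reach

  neighbour-in-a-ball : ∀ {a b x} → Covers j a b → Adj G v x → InBall a x ⊎ InBall b x
  neighbour-in-a-ball {x = x} cov e with cov (col c v x)
  ... | inj₁ cⱼ        = ⊥-elim (no-j (x , e , cⱼ))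
  ... | inj₂ (inj₁ cₐ) = inj₁ (inj₂ (inj₁ (e , cₐ)))
  ... | inj₂ (inj₂ c_b) = inj₂ (inj₂ (inj₁ (e , c_b)))

  outside-disjoint : ∀ {a b x} → Covers j a b → Outside a x → Outside b x → ⊥
  outside-disjoint cov (e , ∉Bₐ) (_ , ∉B_b) = [ ∉Bₐ , ∉B_b ] (neighbour-in-a-ball cov e)

  -- v is joined to a vertex x outside the b-ball by an a-edge, so an a-edge
  -- at x ends in the a-ball.
  a-edge-from-outside-b : ∀ {a b x y} → Covers j a b → Outside b x → ColEdge c a x y → InBall a y
  a-edge-from-outside-b {x = x} cov (e , ∉B_b) xy with cov (col c v x)
  ... | inj₁ cⱼ         = ⊥-elim (no-j (x , e , cⱼ))
  ... | inj₂ (inj₁ cₐ)  = inj₂ (inj₂ (x , (e , cₐ) , xy))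
  ... | inj₂ (inj₂ c_b) = ⊥-elim (∉B_b (inj₂ (inj₁ (e , c_b))))

  -- Edges between R_b and R_a have colour j: colour a or b would put an
  -- endpoint into the corresponding ball.
  cross-edges-coloured-j : ∀ {a b x y} → Covers j a b → Outside b x → Outside a y →
    Adj G x y → ColEdge c j x y
  cross-edges-coloured-j {x = x} {y} cov (ex , ∉B_b) (ey , ∉Bₐ) e with cov (col c x y)
  ... | inj₁ cⱼ         = e , cⱼ
  ... | inj₂ (inj₁ cₐ)  = ⊥-elim (∉Bₐ (a-edge-from-outside-b cov (ex , ∉B_b) (e , cₐ)))
  ... | inj₂ (inj₂ c_b) =
    ⊥-elim (∉B_b (a-edge-from-outside-b (covers-swap cov) (ey , ∉Bₐ) (colEdge-sym c (e , c_b))))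

  both-balls-small : ∀ {a b} → Covers j a b → 2 * ∣ inBall? a ∣ < n → 2 * ∣ inBall? b ∣ < n →
    HasMonoComponentOfOrderAtLeastHalf c n
  both-balls-small {a} {b} cov small-a small-b =
    component-from-set c j y₀ (outside? b ∪? outside? a)
      (dense-pair-connected c (dense b small-b) (dense a small-a) (cross-edges-coloured-j cov) y₀∈Rₐ)
      (thirds-make-half {p = ∣ outside? b ∣} {q = ∣ outside? a ∣}
        (filter-disjoint-∪ (outside? b) (outside? a) (λ r_b rₐ → outside-disjoint cov rₐ r_b) (allFin n))
        (large b small-b) (large a small-a))
    where
    large : ∀ i → 2 * ∣ inBall? i ∣ < n → n < 3 * ∣ outside? i ∣
    large i small = remainder-bound {d = ∣ adj? G v ∣} {B = ∣ inBall? i ∣} {R = ∣ outside? i ∣}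
      (neighbourhood-split i) small (degree-bound v)
    dense : ∀ i → 2 * ∣ inBall? i ∣ < n → CommonNeighbourIn G (Outside i)
    dense i small = large-sets-dense (outside? i) (large i small)
    y₀ : Fin n
    y₀ = proj₁ (dense a small-a v v)
    y₀∈Rₐ : Outside a y₀
    y₀∈Rₐ = proj₁ (proj₂ (dense a small-a v v))

lemma3p1 : (n : ℕ) (G : Graph n) (c : EdgeColouring G 3) →
    MinDegAtLeastFiveSixths G →
    (∃[ v ] ∃[ j ] ¬ IncidentCol c j v) →
    HasMonoComponentOfOrderAtLeastHalf c n
lemma3p1 n G c δ≥ (v , j , no-j) = by-ball-sizes (other-colours j)
  where
  open Ball c v
  open MissingColour c δ≥ v j no-j
  by-ball-sizes : ∃[ a ] ∃[ b ] Covers j a b → HasMonoComponentOfOrderAtLeastHalf c n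
  by-ball-sizes (a , b , cov) with n ≤? 2 * ∣ inBall? a ∣ | n ≤? 2 * ∣ inBall? b ∣
  ... | yes big-a  | _          = ball-component a big-a
  ... | no _       | yes big-b  = ball-component b big-b
  ... | no small-a | no small-b = both-balls-small cov (≰⇒> small-a) (≰⇒> small-b)
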